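{- Let $k\ge 1$, let $G=(V,E)$ be a graph and let $T$ be any $k$-Steiner root of $G$. Then for every clique-intersection $X$ of $G$: (1) $\mathrm{Real}(T\langle X\rangle)=X$ and $\mathrm{diam}(T\langle X\rangle)\le k$; (2) if $T'_X$ is a subtree of $T$ with $T'_X\supsetneq T\langle X\rangle$, then either $X=\mathrm{Real}(T'_X)$ or $\mathrm{diam}(T'_X)>\mathrm{diam}(T\langle X\rangle)$; (3) if $X'$ is a clique-intersection of $G$ with $\mathcal{C}(T\langle X\rangle)\subseteq\mathcal{C}(T\langle X'\rangle)$, then $X\cup X'$ is a clique of $G$.
   Context: A $k$-Steiner root of $G=(V,E)$ is a tree $T$ with $V\subseteq V(T)$ such that for distinct $u,v\in V$, $uv\in E$ iff $\mathrm{dist}_T(u,v)\le k$. Nodes of $T$ in $V$ are real, the others Steiner; for a subtree $T'$, $\mathrm{Real}(T')=V(T')\cap V$. For a nonempty node set $X\subseteq V(T)$, $T\langle X\rangle$ denotes the smallest subtree of $T$ containing $X$. A clique-intersection of $G$ is a nonempty set that is the intersection of a family of (one or more) maximal cliques of $G$. For a tree $T$, $\mathcal{C}(T)$ is its center, the set of nodes of minimum eccentricity in $T$. -}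

module Defs where

open import Data.Nat using (ℕ; zero; suc; _≤_; _<_)
open import Data.Fin using (Fin)
open import Data.Fin.Subset using (Subset; _∈_; _∉_; _⊆_; _∪_; Nonempty; ⊤)
open import Data.List using (List; []; _∷_)
open import Data.List.Relation.Unary.All using (All)
open import Data.List.Relation.Unary.Unique.Propositional using (Unique)
open import Data.Product using (Σ; ∃; ∃-syntax; _×_; _,_)
open import Data.Sum using (_⊎_)
open import Relation.Nullary using (¬_; Dec)
open import Relation.Binary.PropositionalEquality using (_≡_; _≢_)
open import Function.Definitions using (Injective)

record SimpleGraph (n : ℕ) : Set₁ where
  field
    Adj    : Fin n → Fin n → Set
    adj?   : ∀ u v → Dec (Adj u v)
    sym    : ∀ {u v} → Adj u v → Adj v u
    irrefl : ∀ {u} → ¬ Adj u u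

open SimpleGraph public

module _ {m : ℕ} (T : SimpleGraph m) where

  data Walk (S : Subset m) : Fin m → Fin m → ℕ → Set where
    stop : ∀ {u} → u ∈ S → Walk S u u 0
    step : ∀ {u w v l} → u ∈ S → Adj T u w → Walk S w v l → Walk S u v (suc l)

  verts : ∀ {S u v l} → Walk S u v l → List (Fin m)
  verts (stop {u} _)       = u ∷ []
  verts (step {u} _ _ p)   = u ∷ verts p

  ConnectedOn : Subset m → Set
  ConnectedOn S = ∀ {u v} → u ∈ S → v ∈ S → ∃[ l ] Walk S u v l

  -- no cycle: no path u … v with ≥ 2 edges whose ends are adjacent
  Acyclic : Set
  Acyclic = ∀ {u v l} (p : Walk ⊤ u v l) → 2 ≤ l → Unique (verts p) → ¬ Adj T v u

  -- T is a tree: nonempty, connected, acyclic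
  IsTree : Set
  IsTree = Fin m × ConnectedOn ⊤ × Acyclic

  Dist : Subset m → Fin m → Fin m → ℕ → Set
  Dist S u v d = Walk S u v d × (∀ {l} → Walk S u v l → d ≤ l)

  -- subtree of T = nonempty connected node set (its induced subgraph)
  Subtree : Subset m → Set
  Subtree S = Nonempty S × ConnectedOn S

  _⊂_ : Subset m → Subset m → Set
  S ⊂ S' = S ⊆ S' × ∃[ v ] (v ∈ S' × v ∉ S)

  Diam : Subset m → ℕ → Set
  Diam S d = (∀ {u v e} → u ∈ S → v ∈ S → Dist S u v e → e ≤ d)
           × ∃[ u ] ∃[ v ] (u ∈ S × v ∈ S × Dist S u v d)

  Ecc : Subset m → Fin m → ℕ → Set
  Ecc S v e = (∀ {w d} → w ∈ S → Dist S v w d → d ≤ e)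
            × ∃[ w ] (w ∈ S × Dist S v w e)

  InCenter : Subset m → Fin m → Set
  InCenter S c = c ∈ S × (∀ {e v e'} → Ecc S c e → v ∈ S → Ecc S v e' → e ≤ e')

module _ {n : ℕ} (G : SimpleGraph n) where

  IsClique : Subset n → Set
  IsClique C = ∀ {u v} → u ∈ C → v ∈ C → u ≢ v → Adj G u v

  IsMaximalClique : Subset n → Set
  IsMaximalClique C = IsClique C × (∀ D → IsClique D → C ⊆ D → D ⊆ C)

  IsCliqueIntersection : Subset n → Set
  IsCliqueIntersection X =
    Nonempty X ×
    ∃[ F ] (F ≢ [] × All IsMaximalClique F ×
            (∀ u → (u ∈ X → All (u ∈_) F) × (All (u ∈_) F → u ∈ X)))

module _ {n m : ℕ} where

  -- T (a tree on Fin m) with V embedded via emb is a k-Steiner root of G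
  IsSteinerRoot : ℕ → SimpleGraph n → SimpleGraph m → (Fin n → Fin m) → Set
  IsSteinerRoot k G T emb =
    IsTree T × Injective _≡_ _≡_ emb ×
    (∀ u v → u ≢ v →
       (Adj G u v → ∃[ d ] (Dist T ⊤ (emb u) (emb v) d × d ≤ k)) ×
       (∃[ d ] (Dist T ⊤ (emb u) (emb v) d × d ≤ k) → Adj G u v))

  RealIs : (Fin n → Fin m) → Subset m → Subset n → Set
  RealIs emb S X = ∀ u → (emb u ∈ S → u ∈ X) × (u ∈ X → emb u ∈ S)

  -- S is T⟨X⟩: the smallest subtree of T containing (the image of) X
  IsSpan : SimpleGraph m → (Fin n → Fin m) → Subset n → Subset m → Set
  IsSpan T emb X S =
    Subtree T S × (∀ {u} → u ∈ X → emb u ∈ S) ×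
    (∀ S' → Subtree T S' → (∀ {u} → u ∈ X → emb u ∈ S') → S ⊆ S')

-- Because T is acyclic, the
-- distance to a fixed vertex z changes by exactly one along every edge, and every
-- vertex has a unique neighbour closer to z.  Hence non-backtracking walks are
-- shortest, distances inside a subtree are tree distances, and along a geodesic
-- a … b the distance to z first decreases and then increases by one per step
-- (the valley lemma).  Three consequences of the valley lemma drive the proof:
-- a geodesic vertex is no farther from z than one of the ends; the middle of a
-- diametral path of a subtree is a center; and a vertex within diam(S) of both ends
-- of a diametral path of S is no farther from any z than one of these ends.
-- The span T⟨X⟩ lies in the union of the geodesics between points of X, so each of
-- its vertices is as close to any z as the farthest point of X.  For a
-- clique-intersection X this yields (1) by maximality of the cliques, (2) by finding a
-- real vertex of S' outside X that is far from both ends of a diametral path of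
-- T⟨X⟩, and (3) by the triangle inequality through a common center.

module Submission where

open import Defs
open import Data.Nat using (ℕ; zero; suc; _+_; _≤_; _<_; z≤n; s≤s; s≤s⁻¹; _≤?_; _<?_)
open import Data.Nat.Properties
  using (module ≤-Reasoning; anyUpTo?;
         ≤-refl; ≤-reflexive; ≤-trans; ≤-antisym; <⇒≤; <-irrefl; <-cmp; n≤1+n; m≤m+n; m≤n+m; ≰⇒>; ≮⇒≥;
         +-suc; +-comm; +-assoc; +-identityʳ; +-mono-≤; +-monoˡ-≤; +-monoʳ-≤; +-cancelʳ-≤; +-cancelˡ-≤;
         +-cancelʳ-≡; suc-injective; m≤n⇒m<n∨m≡n; m≤n⇒∃[o]m+o≡n; m≢1+m+n)
open import Data.Nat.Tactic.RingSolver using (solve-∀)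
open import Data.Fin using (Fin) renaming (_≟_ to _≟ᶠ_)
open import Data.Fin.Subset using (Subset; _∈_; _∉_; _⊆_; ⊤; _∪_; ⁅_⁆; Nonempty)
open import Data.Fin.Subset.Properties using (∈⊤; _∈?_; x∈p∪q⁻; p⊆p∪q; q⊆p∪q; x∈⁅x⁆; x∈⁅y⁆⇒x≡y)
open import Data.Fin.Properties using (any?)
open import Data.Bool using (true)
open import Data.Vec using (tabulate)
open import Data.Vec.Properties using ([]=⇒lookup; lookup⇒[]=; lookup∘tabulate)
open import Data.List using (List; []; _∷_; _++_; [_]; filter; upTo; allFin)
open import Data.List.Extrema.Nat using (argmin; argmax; argmin-all; argmax-all; f[argmin]≤f[xs];
                                         f[argmin]≤f[⊤]; f[xs]≤f[argmax])
open import Data.List.Membership.Propositional using (find) renaming (_∈_ to _∈ᴸ_)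
open import Data.List.Membership.Propositional.Properties using (∈-filter⁺; ∈-upTo⁺; ∈-allFin)
open import Data.List.Relation.Unary.All as All using (All; []; _∷_)
open import Data.List.Relation.Unary.All.Properties using (all-filter; ++⁺; ¬All⇒Any¬)
open import Data.List.Relation.Unary.Unique.Propositional using (Unique)
import Data.List.Relation.Unary.Unique.Propositional.Properties as Unique
open import Data.List.Relation.Unary.Any using (here)
open import Data.List.Relation.Unary.AllPairs using ([]; _∷_)
open import Data.Product using (Σ; ∃-syntax; _×_; _,_; proj₁; proj₂)
open import Data.Sum using (_⊎_; inj₁; inj₂)
open import Data.Unit using (tt) renaming (⊤ to Unit)
open import Data.Empty using (⊥; ⊥-elim)
open import Function using (id)
open import Relation.Nullary using (¬_; Dec; yes; no; does)
open import Relation.Nullary.Decidable using (_×-dec_; ¬?; decidable-stable; map′; dec-true)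
open import Relation.Unary using (Decidable)
open import Relation.Binary using (tri<; tri≈; tri>)
open import Relation.Binary.PropositionalEquality
  using (_≡_; _≢_; refl; cong; subst; subst₂; trans; module ≡-Reasoning) renaming (sym to ≡-sym)

split≤ : ∀ {i j} → i ≤ j → Σ ℕ λ t → t + i ≡ j
split≤ {i} i≤j with m≤n⇒∃[o]m+o≡n i≤j
... | t , i+t≡j = t , trans (+-comm t i) i+t≡j

interchange : ∀ a b c d → (a + b) + (c + d) ≡ (c + b) + (a + d)
interchange = solve-∀

bounded-sum : ∀ {c j x y} → c ≤ j → x + j ≡ y → c + x ≤ y
bounded-sum {c} {j} {x} c≤j x+j≡y = subst (c + x ≤_) (trans (+-comm j x) x+j≡y) (+-monoˡ-≤ x c≤j)

double-sum : ∀ a b → (a + b) + (a + b) ≡ (a + a) + (b + b)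
double-sum = solve-∀

parity : ∀ n → Σ ℕ λ q → n ≡ q + q ⊎ n ≡ suc (q + q)
parity zero = 0 , inj₁ refl
parity (suc n) with parity n
... | q , inj₁ even = q , inj₂ (cong suc even)
... | q , inj₂ odd = suc q , inj₁ (trans (cong suc odd) (cong suc (≡-sym (+-suc q q))))

half-≤ : ∀ {x y} → x + x ≤ suc (y + y) → x ≤ y
half-≤ {x} {y} h with x ≤? y
... | yes x≤y = x≤y
... | no x≰y = ⊥-elim (<-irrefl refl
  (subst (_≤ suc (y + y)) (cong suc (+-suc y y)) (≤-trans (+-mono-≤ (≰⇒> x≰y) (≰⇒> x≰y)) h)))

sum-of-halves : ∀ {a b k} → a + a ≤ k → b + b ≤ suc k → a + b ≤ k
sum-of-halves {a} {b} {k} 2a≤k 2b≤1+k = half-≤ (begin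
  (a + b) + (a + b)   ≡⟨ double-sum a b ⟩
  (a + a) + (b + b)   ≤⟨ +-mono-≤ 2a≤k 2b≤1+k ⟩
  k + suc k           ≡⟨ +-suc k k ⟩
  suc (k + k)         ∎)
  where open ≤-Reasoning

nonempty-member : ∀ {A : Set} (xs : List A) → xs ≢ [] → Σ A (_∈ᴸ xs)
nonempty-member [] xs≢[] = ⊥-elim (xs≢[] refl)
nonempty-member (x ∷ _) _ = x , here refl

least : ∀ {P : ℕ → Set} → Decidable P → ∀ {w} → P w → Σ ℕ λ n → P n × (∀ {j} → P j → n ≤ j)
least {P} P? {w} pw = n , argmin-all id pw (all-filter P? (upTo w)) , n-least
  where
  candidates : List ℕ
  candidates = filter P? (upTo w)
  n : ℕ
  n = argmin id w candidates
  n-least : ∀ {j} → P j → n ≤ j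
  n-least {j} pj with j <? w
  ... | yes j<w = All.lookup (f[argmin]≤f[xs] {f = id} w candidates) (∈-filter⁺ P? (∈-upTo⁺ j<w) pj)
  ... | no j≮w = ≤-trans (f[argmin]≤f[⊤] {f = id} w candidates) (≮⇒≥ j≮w)

module Maximiser {m : ℕ} (S : Subset m) (s : Fin m) (s∈S : s ∈ S) (f : Fin m → ℕ) where

  members : List (Fin m)
  members = filter (_∈? S) (allFin m)

  abstract
    maximiser : Fin m
    maximiser = argmax f s members

    maximiser-∈ : maximiser ∈ S
    maximiser-∈ = argmax-all f s∈S (all-filter (_∈? S) (allFin m))

    maximiser-max : ∀ {v} → v ∈ S → f v ≤ f maximiser
    maximiser-max {v} v∈S =
      All.lookup (f[xs]≤f[argmax] {f = f} s members) (∈-filter⁺ (_∈? S) (∈-allFin v) v∈S)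

module Walks {m : ℕ} (T : SimpleGraph m) where

  _++ᵂ_ : ∀ {S u w v l l'} → Walk T S u w l → Walk T S w v l' → Walk T S u v (l + l')
  stop _ ++ᵂ q = q
  step x a p ++ᵂ q = step x a (p ++ᵂ q)

  snocᵂ : ∀ {S u v w l} → Walk T S u v l → Adj T v w → w ∈ S → Walk T S u w (suc l)
  snocᵂ (stop x) a w∈S = step x a (stop w∈S)
  snocᵂ (step x a p) b w∈S = step x a (snocᵂ p b w∈S)

  verts-snocᵂ : ∀ {S u v w l} (p : Walk T S u v l) (a : Adj T v w) (w∈S : w ∈ S) →
                verts T (snocᵂ p a w∈S) ≡ verts T p ++ [ w ]
  verts-snocᵂ (stop x) a w∈S = refl
  verts-snocᵂ (step x b p) a w∈S = cong (_ ∷_) (verts-snocᵂ p a w∈S)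

  reverseᵂ : ∀ {S u v l} → Walk T S u v l → Walk T S v u l
  reverseᵂ (stop x) = stop x
  reverseᵂ (step x a p) = snocᵂ (reverseᵂ p) (sym T a) x

  weakenᵂ : ∀ {S S' u v l} → S ⊆ S' → Walk T S u v l → Walk T S' u v l
  weakenᵂ h (stop x) = stop (h x)
  weakenᵂ h (step x a p) = step (h x) a (weakenᵂ h p)

  empty-walk : ∀ {S u v} → Walk T S u v 0 → u ≡ v
  empty-walk (stop _) = refl

  walk? : ∀ S u v l → Dec (Walk T S u v l)
  walk? S u v zero with u ∈? S | u ≟ᶠ v
  ... | yes u∈S | yes refl = yes (stop u∈S)
  ... | no u∉S  | _        = no λ { (stop x) → u∉S x }
  ... | yes _   | no u≢v   = no λ { (stop _) → u≢v refl }
  walk? S u v (suc l) with u ∈? S | any? (λ w → adj? T u w ×-dec walk? S w v l)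
  ... | yes u∈S | yes (w , a , p) = yes (step u∈S a p)
  ... | no u∉S  | _               = no λ { (step x _ _) → u∉S x }
  ... | yes _   | no none         = no λ { (step _ a p) → none (_ , a , p) }

  -- the i-th vertex of a walk (the last one for i beyond its length)
  vertexAt : ∀ {S u v l} → Walk T S u v l → ℕ → Fin m
  vertexAt (stop {u} _) _ = u
  vertexAt (step {u} _ _ p) zero = u
  vertexAt (step _ _ p) (suc i) = vertexAt p i

  vertexAt-start : ∀ {S u v l} (p : Walk T S u v l) → vertexAt p 0 ≡ u
  vertexAt-start (stop _) = refl
  vertexAt-start (step _ _ _) = refl

  vertexAt-end : ∀ {S u v l} (p : Walk T S u v l) → vertexAt p l ≡ v
  vertexAt-end (stop _) = refl
  vertexAt-end (step _ _ p) = vertexAt-end p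

  vertexAt-∈ : ∀ {S u v l} (p : Walk T S u v l) i → vertexAt p i ∈ S
  vertexAt-∈ (stop x) i = x
  vertexAt-∈ (step x _ _) zero = x
  vertexAt-∈ (step _ _ p) (suc i) = vertexAt-∈ p i

  vertexAt-adj : ∀ {S u v l} (p : Walk T S u v l) i → suc i ≤ l →
                 Adj T (vertexAt p i) (vertexAt p (suc i))
  vertexAt-adj (step x a p) zero _ = subst (Adj T _) (≡-sym (vertexAt-start p)) a
  vertexAt-adj (step x a p) (suc i) (s≤s i<l) = vertexAt-adj p i i<l

  walkAlong : ∀ {S} (g : ℕ → Fin m) (L : ℕ) →
              (∀ j → suc j ≤ L → Adj T (g j) (g (suc j))) → (∀ j → j ≤ L → g j ∈ S) →
              ∀ l i → l + i ≤ L → Walk T S (g i) (g (l + i)) l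
  walkAlong g L adj mem zero i h = stop (mem i h)
  walkAlong {S} g L adj mem (suc l) i h =
    step (mem i (≤-trans (m≤n+m i (suc l)) h)) (adj i (≤-trans (s≤s (m≤n+m i l)) h))
      (subst (λ x → Walk T S (g (suc i)) (g x) l) (+-suc l i)
        (walkAlong g L adj mem l (suc i) (subst (_≤ L) (≡-sym (+-suc l i)) h)))

module TreeMetric {m : ℕ} (T : SimpleGraph m) (tree : IsTree T) where
  open Walks T

  connected : ConnectedOn T ⊤
  connected = proj₁ (proj₂ tree)

  acyclic : Acyclic T
  acyclic = proj₂ (proj₂ tree)

  -- dist u v is the length of a shortest walk from u to v in T; it is kept opaque,
  -- as only the properties established below are used
  abstract
    shortest : ∀ u v → Σ ℕ λ l → Walk T ⊤ u v l × (∀ {j} → Walk T ⊤ u v j → l ≤ j)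
    shortest u v = least (walk? ⊤ u v) (proj₂ (connected ∈⊤ ∈⊤))

    dist : Fin m → Fin m → ℕ
    dist u v = proj₁ (shortest u v)

    dist-walk : ∀ u v → Walk T ⊤ u v (dist u v)
    dist-walk u v = proj₁ (proj₂ (shortest u v))

    dist-minimal : ∀ {S u v l} → Walk T S u v l → dist u v ≤ l
    dist-minimal {u = u} {v} p = proj₂ (proj₂ (shortest u v)) (weakenᵂ (λ _ → ∈⊤) p)

  dist-sym : ∀ u v → dist u v ≡ dist v u
  dist-sym u v = ≤-antisym (dist-minimal (reverseᵂ (dist-walk v u)))
                           (dist-minimal (reverseᵂ (dist-walk u v)))

  dist-triangle : ∀ u w v → dist u v ≤ dist u w + dist w v
  dist-triangle u w v = dist-minimal (dist-walk u w ++ᵂ dist-walk w v)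

  dist-refl : ∀ u → dist u u ≡ 0
  dist-refl u = ≤-antisym (dist-minimal (stop {S = ⊤} (∈⊤ {x = u}))) z≤n

  dist≡0 : ∀ {u v} → dist u v ≡ 0 → u ≡ v
  dist≡0 {u} {v} eq = empty-walk (subst (Walk T ⊤ u v) eq (dist-walk u v))

  dist-adj≤ : ∀ z {u w} → Adj T u w → dist z w ≤ suc (dist z u)
  dist-adj≤ z {u} a = dist-minimal (snocᵂ (dist-walk z u) a ∈⊤)

  dist-adj : ∀ {u v} → Adj T u v → dist u v ≡ 1
  dist-adj {u} {v} a with dist u v | dist-minimal (step {S = ⊤} ∈⊤ a (stop ∈⊤)) | dist≡0 {u} {v}
  ... | zero        | _      | u≡v = ⊥-elim (irrefl T (subst (Adj T u) (≡-sym (u≡v refl)) a))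
  ... | suc zero    | _      | _   = refl
  ... | suc (suc _) | s≤s () | _

  parent : ∀ z y s → dist z y ≡ suc s → Σ (Fin m) λ y' → Adj T y' y × dist z y' ≡ s
  parent z y s eq with subst (Walk T ⊤ y z) (trans (dist-sym y z) eq) (dist-walk y z)
  ... | step {w = w} _ a p =
    w , sym T a ,
    ≤-antisym (subst (_≤ s) (dist-sym w z) (dist-minimal p))
              (s≤s⁻¹ (subst (_≤ suc (dist z w)) eq (dist-adj≤ z (sym T a))))

  off-level : ∀ z {s x} {ws : List (Fin m)} → All (λ w → s < dist z w) ws → dist z x ≡ s →
              All (x ≢_) ws
  off-level z above xs =
    All.map (λ h x≡w → <-irrefl (≡-sym xs) (subst (λ t → _ < dist z t) (≡-sym x≡w) h)) above

  -- No simple path joins two distinct vertices of level s while staying on levels ≥ s: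
  -- descending from both ends to level s-1 either closes a cycle (common parent)
  -- or gives such a path one level lower.
  no-level-path : ∀ z s {p q l} (W : Walk T ⊤ p q l) → p ≢ q → Unique (verts T W) →
                  All (λ w → s ≤ dist z w) (verts T W) → dist z p ≡ s → dist z q ≡ s → ⊥
  no-level-path z zero {p} {q} W p≢q _ _ p0 q0 = p≢q (trans (≡-sym (dist≡0 p0)) (dist≡0 q0))
  no-level-path z (suc s) {p} {q} {l} W p≢q unique above ps qs
    with parent z p s ps | parent z q s qs
  ... | p' , p'p , p's | q' , q'q , q's with p' ≟ᶠ q'
  ...   | yes refl =
    acyclic (step ∈⊤ p'p W) (two-edges W) (off-level z above p's ∷ unique) (sym T q'q)
    where
    two-edges : ∀ {l'} → Walk T ⊤ p q l' → 2 ≤ suc l'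
    two-edges {zero} W0 = ⊥-elim (p≢q (empty-walk W0))
    two-edges {suc _} _ = s≤s (s≤s z≤n)
  ...   | no p'≢q' = no-level-path z s W' p'≢q' unique' above' p's q's
    where
    W' : Walk T ⊤ p' q' (suc (suc l))
    W' = step ∈⊤ p'p (snocᵂ W (sym T q'q) ∈⊤)
    unique' : Unique (verts T W')
    unique' rewrite verts-snocᵂ W (sym T q'q) ∈⊤ =
      ++⁺ (off-level z above p's) (p'≢q' ∷ []) ∷
      Unique.++⁺ unique ([] ∷ []) λ { (w∈W , here refl) → All.lookup (off-level z above q's) w∈W refl }
    above' : All (λ w → s ≤ dist z w) (verts T W')
    above' rewrite verts-snocᵂ W (sym T q'q) ∈⊤ =
      subst (s ≤_) (≡-sym p's) ≤-refl ∷
        ++⁺ (All.map (≤-trans (n≤1+n s)) above) (subst (s ≤_) (≡-sym q's) ≤-refl ∷ [])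

  adjacent-levels-differ : ∀ z {y w} → Adj T y w → dist z y ≢ dist z w
  adjacent-levels-differ z {y} {w} a eq =
    no-level-path z (dist z y) (step {S = ⊤} ∈⊤ a (stop ∈⊤)) y≢w ((y≢w ∷ []) ∷ [] ∷ [])
      (≤-refl ∷ subst (dist z y ≤_) eq ≤-refl ∷ []) refl (≡-sym eq)
    where
    y≢w : y ≢ w
    y≢w refl = irrefl T a

  unique-parent : ∀ z {y₁ y y₂} → Adj T y₁ y → Adj T y y₂ → y₁ ≢ y₂ →
                  dist z y₁ ≡ dist z y₂ → dist z y ≢ suc (dist z y₁)
  unique-parent z {y₁} {y} {y₂} a b y₁≢y₂ same up =
    no-level-path z (dist z y₁) (step {S = ⊤} ∈⊤ a (step ∈⊤ b (stop ∈⊤))) y₁≢y₂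
      ((y₁≢y ∷ y₁≢y₂ ∷ []) ∷ (y≢y₂ ∷ []) ∷ [] ∷ [])
      (≤-refl ∷ subst (dist z y₁ ≤_) (≡-sym up) (n≤1+n _) ∷ subst (dist z y₁ ≤_) same ≤-refl ∷ [])
      refl (≡-sym same)
    where
    y₁≢y : y₁ ≢ y
    y₁≢y refl = irrefl T a
    y≢y₂ : y ≢ y₂
    y≢y₂ refl = irrefl T b

  adjacent-levels : ∀ z {u w} → Adj T u w → dist z w ≡ suc (dist z u) ⊎ dist z u ≡ suc (dist z w)
  adjacent-levels z {u} {w} a with <-cmp (dist z u) (dist z w)
  ... | tri< lt _ _ = inj₁ (≤-antisym (dist-adj≤ z a) lt)
  ... | tri≈ _ eq _ = ⊥-elim (adjacent-levels-differ z a eq)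
  ... | tri> _ _ gt = inj₂ (≤-antisym (dist-adj≤ z (sym T a)) gt)

  -- Non-backtracking walks (no step immediately undoes the previous one) are shortest.
  SecondVertexNot : ∀ {S w v l} → Fin m → Walk T S w v l → Set
  SecondVertexNot u (stop _) = Unit
  SecondVertexNot u (step {w = w'} _ _ _) = u ≢ w'

  NonBacktracking : ∀ {S u v l} → Walk T S u v l → Set
  NonBacktracking (stop _) = Unit
  NonBacktracking (step {u} _ _ p) = SecondVertexNot u p × NonBacktracking p

  -- seen from its end v, each step of such a walk climbs one level (parents are unique)
  nonBacktracking-length : ∀ {S u v l} (W : Walk T S u v l) → NonBacktracking W → dist v u ≡ l
  nonBacktracking-length {v = v} (stop _) _ = dist-refl v
  nonBacktracking-length (step x a (stop _)) _ = dist-adj (sym T a)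
  nonBacktracking-length {v = v} (step x a (step y b q)) (u≢w₂ , nb@(_ , nbq))
    with nonBacktracking-length (step y b q) nb | nonBacktracking-length q nbq | adjacent-levels v a
  ... | lenW | lenq | inj₂ down = trans down (cong suc lenW)
  ... | lenW | lenq | inj₁ up =
    ⊥-elim (unique-parent v a b u≢w₂ (trans (suc-injective (trans (≡-sym up) lenW)) (≡-sym lenq)) up)

  shortcut : ∀ {S u v l} (W : Walk T S u v l) → Σ ℕ λ l' → l' ≤ l × Σ (Walk T S u v l') NonBacktracking
  shortcut (stop x) = 0 , z≤n , stop x , tt
  shortcut (step {u} x a p) with shortcut p
  ... | _ , _ , stop y , _ = 1 , s≤s z≤n , step x a (stop y) , tt , tt
  ... | suc l'' , l'≤ , step {w = w₂} y b q , nb with u ≟ᶠ w₂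
  ...   | yes refl = l'' , ≤-trans (n≤1+n l'') (≤-trans l'≤ (n≤1+n _)) , q , proj₂ nb
  ...   | no u≢w₂ = suc (suc l'') , s≤s l'≤ , step x a (step y b q) , u≢w₂ , nb

  dist-in-subtree : ∀ {S u v} → ConnectedOn T S → u ∈ S → v ∈ S → Dist T S u v (dist u v)
  dist-in-subtree {S} {u} {v} conn u∈S v∈S with conn u∈S v∈S
  ... | l , W with shortcut W
  ...   | _ , _ , W' , nb =
    subst (Walk T S u v) (≡-sym (trans (dist-sym u v) (nonBacktracking-length W' nb))) W' , dist-minimal

  Dist⇒dist : ∀ {S u v e} → Dist T S u v e → e ≡ dist u v
  Dist⇒dist {u = u} {v} (W , minimal) with shortcut W
  ... | _ , l'≤e , W' , nb =
    trans (≤-antisym (minimal W') l'≤e) (trans (≡-sym (nonBacktracking-length W' nb)) (dist-sym v u))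

module Geodesic {m : ℕ} (T : SimpleGraph m) (tree : IsTree T)
                {S : Subset m} {a b : Fin m} (W : Walk T S a b (TreeMetric.dist T tree a b)) where
  open Walks T
  open TreeMetric T tree

  D : ℕ
  D = dist a b

  g : ℕ → Fin m
  g = vertexAt W

  g-start : g 0 ≡ a
  g-start = vertexAt-start W

  g-end : g D ≡ b
  g-end = vertexAt-end W

  g-adj : ∀ j → suc j ≤ D → Adj T (g j) (g (suc j))
  g-adj = vertexAt-adj W

  g-∈ : ∀ j → g j ∈ S
  g-∈ = vertexAt-∈ W

  position : ∀ i → i ≤ D → dist a (g i) ≡ i
  position i i≤D with split≤ i≤D
  ... | t , t+i≡D = ≤-antisym to-g from-g
    where
    segment : ∀ l i → l + i ≤ D → Walk T S (g i) (g (l + i)) l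
    segment = walkAlong g D g-adj (λ j _ → g-∈ j)
    to-g : dist a (g i) ≤ i
    to-g = subst₂ (λ x y → dist x (g y) ≤ i) g-start (+-identityʳ i)
             (dist-minimal (segment i 0 (subst (_≤ D) (≡-sym (+-identityʳ i)) i≤D)))
    from-g : i ≤ dist a (g i)
    from-g = +-cancelʳ-≤ t i (dist a (g i))
      (subst (_≤ dist a (g i) + t) (trans (≡-sym t+i≡D) (+-comm t i))
        (≤-trans (dist-triangle a (g i) b)
          (+-monoʳ-≤ (dist a (g i))
            (subst (λ x → dist (g i) x ≤ t) (trans (cong g t+i≡D) g-end)
              (dist-minimal (segment t i (subst (_≤ D) (≡-sym t+i≡D) ≤-refl)))))))

  skip-distinct : ∀ i → suc (suc i) ≤ D → g i ≢ g (suc (suc i))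
  skip-distinct i h eq = m≢1+m+n i {1}
    (trans (≡-sym (position i (≤-trans (n≤1+n i) (≤-trans (n≤1+n (suc i)) h))))
      (trans (cong (dist a) eq) (trans (position (suc (suc i)) h) (cong suc (+-comm 1 i)))))

  -- Seen from any vertex z, the distance along the geodesic first decreases and then
  -- increases, by exactly one per step: its graph is a valley with bottom at index j.
  module Valley (z : Fin m) where

    f : ℕ → ℕ
    f i = dist z (g i)

    -- once the distance rises, it keeps rising (a second descent would need two parents)
    keeps-rising : ∀ p → (suc p ≤ D → f p ≤ f (suc p)) →
                   ∀ t → suc t + p ≤ D → f (suc t + p) ≡ suc (f (t + p))
    keeps-rising p rise zero h with adjacent-levels z (g-adj p h)
    ... | inj₁ up = up
    ... | inj₂ down = ⊥-elim (<-irrefl down (s≤s (rise h)))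
    keeps-rising p rise (suc s) h with adjacent-levels z (g-adj (suc s + p) h)
    ... | inj₁ up = up
    ... | inj₂ down = ⊥-elim (unique-parent z (g-adj (s + p) (≤-trans (n≤1+n _) h))
                        (g-adj (suc s + p) h) (skip-distinct (s + p) h)
                        (suc-injective (trans (≡-sym previous) down)) previous)
      where
      previous : f (suc s + p) ≡ suc (f (s + p))
      previous = keeps-rising p rise s (≤-trans (n≤1+n _) h)

    rising : ∀ p → (suc p ≤ D → f p ≤ f (suc p)) → ∀ t → t + p ≤ D → f (t + p) ≡ t + f p
    rising p rise zero h = refl
    rising p rise (suc t) h =
      trans (keeps-rising p rise t h) (cong suc (rising p rise t (≤-trans (n≤1+n _) h)))

    Descending : ℕ → Set
    Descending p = ∀ i → i ≤ p → f i + i ≡ f 0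

    Ascending : ℕ → Set
    Ascending j = ∀ t → t + j ≤ D → f (t + j) ≡ t + f j

    descend-or-turn : ∀ p → p ≤ D → Descending p ⊎ Σ ℕ λ j → j ≤ p × Descending j × Ascending j
    descend-or-turn zero _ = inj₁ λ { zero z≤n → +-identityʳ _ }
    descend-or-turn (suc p) h with descend-or-turn p (≤-trans (n≤1+n p) h)
    ... | inj₂ (j , j≤p , desc , asc) = inj₂ (j , ≤-trans j≤p (n≤1+n p) , desc , asc)
    ... | inj₁ desc with adjacent-levels z (g-adj p h)
    ...   | inj₁ up = inj₂ (p , n≤1+n p , desc , rising p (λ _ → subst (f p ≤_) (≡-sym up) (n≤1+n _)))
    ...   | inj₂ down = inj₁ desc'
      where
      desc' : Descending (suc p)
      desc' i i≤ with m≤n⇒m<n∨m≡n i≤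
      ... | inj₁ i<1+p = desc i (s≤s⁻¹ i<1+p)
      ... | inj₂ refl = trans (+-suc (f (suc p)) p) (trans (cong (_+ p) (≡-sym down)) (desc p ≤-refl))

    record Bottom : Set where
      field
        j          : ℕ
        j≤D        : j ≤ D
        descending : Descending j
        ascending  : Ascending j

    bottom : Bottom
    bottom with descend-or-turn D ≤-refl
    ... | inj₂ (j , j≤D , desc , asc) = record { j = j ; j≤D = j≤D ; descending = desc ; ascending = asc }
    ... | inj₁ desc = record { j = D ; j≤D = ≤-refl ; descending = desc ; ascending = asc }
      where
      asc : Ascending D
      asc zero _ = refl
      asc (suc t) h = ⊥-elim (<-irrefl refl (≤-trans (s≤s (m≤n+m D t)) h))

    open Bottom bottom public

    valley-shape : ∀ p → p ≤ D → f p + p ≡ f 0 ⊎ f p + D ≡ f D + p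
    valley-shape p p≤D with j ≤? p
    ... | no p≱j = inj₁ (descending p (<⇒≤ (≰⇒> p≱j)))
    ... | yes j≤p with split≤ j≤p | split≤ j≤D
    ...   | t , t+j≡p | t' , t'+j≡D =
      inj₂ (subst₂ (λ x y → f x + y ≡ f y + x) t+j≡p t'+j≡D (begin
        f (t + j) + (t' + j)   ≡⟨ cong (_+ (t' + j)) (ascending t (subst (_≤ D) (≡-sym t+j≡p) p≤D)) ⟩
        (t + f j) + (t' + j)   ≡⟨ interchange t (f j) t' j ⟩
        (t' + f j) + (t + j)   ≡⟨ cong (_+ (t + j)) (≡-sym (ascending t' (subst (_≤ D) (≡-sym t'+j≡D) ≤-refl))) ⟩
        f (t' + j) + (t + j)   ∎))
      where open ≡-Reasoning

  closer-than-an-end : ∀ z p → p ≤ D → dist (g p) z ≤ dist a z ⊎ dist (g p) z ≤ dist b z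
  closer-than-an-end z p p≤D with Valley.valley-shape z p p≤D
  ... | inj₁ eq = inj₁ (subst₂ _≤_ (dist-sym z (g p)) (trans (cong (dist z) g-start) (dist-sym z a))
                          (subst (dist z (g p) ≤_) eq (m≤m+n _ _)))
  ... | inj₂ eq = inj₂ (subst₂ _≤_ (dist-sym z (g p)) (trans (cong (dist z) g-end) (dist-sym z b))
                          (+-cancelʳ-≤ D _ _ (subst (_≤ dist z (g D) + D) (≡-sym eq) (+-monoʳ-≤ _ p≤D))))

  within-radius : ∀ v p r → p ≤ D → p ≤ r → D ≤ p + r → dist v a ≤ D → dist v b ≤ D →
                  dist v (g p) ≤ r
  within-radius v p r p≤D p≤r D≤p+r va vb with Valley.valley-shape v p p≤D
  ... | inj₁ eq = +-cancelʳ-≤ p _ r (begin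
        dist v (g p) + p   ≡⟨ trans eq (cong (dist v) g-start) ⟩
        dist v a           ≤⟨ ≤-trans va D≤p+r ⟩
        p + r              ≡⟨ +-comm p r ⟩
        r + p              ∎)
    where open ≤-Reasoning
  ... | inj₂ eq = ≤-trans (+-cancelʳ-≤ D _ p (begin
        dist v (g p) + D   ≡⟨ trans eq (cong (λ x → dist v x + p) g-end) ⟩
        dist v b + p       ≤⟨ +-monoˡ-≤ p vb ⟩
        D + p              ≡⟨ +-comm D p ⟩
        p + D              ∎)) p≤r
    where open ≤-Reasoning

  -- If w is within D of both ends, then for every z, w is no farther from z than one of the ends.
  -- (Take the bottom j of the valley of w: w is within j and within D - j of g j.)
  dominated : ∀ w z → dist w a ≤ D → dist w b ≤ D → dist w z ≤ dist z a ⊎ dist w z ≤ dist z b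
  dominated w z wa wb with split≤ (Valley.j≤D w)
  ... | t' , t'+j≡D = result
    where
    open Valley w using (j; j≤D; descending; ascending)
    c : ℕ
    c = dist w (g j)
    w-to-a : c + j ≡ dist w a
    w-to-a = trans (descending j ≤-refl) (cong (dist w) g-start)
    w-to-b : t' + c ≡ dist w b
    w-to-b = trans (≡-sym (ascending t' (subst (_≤ D) (≡-sym t'+j≡D) ≤-refl)))
                   (cong (dist w) (trans (cong g t'+j≡D) g-end))
    c≤t' : c ≤ t'
    c≤t' = +-cancelʳ-≤ j c t' (subst₂ _≤_ (≡-sym w-to-a) (≡-sym t'+j≡D) wa)
    c≤j : c ≤ j
    c≤j = +-cancelˡ-≤ t' c j (subst₂ _≤_ (≡-sym w-to-b) (≡-sym t'+j≡D) wb)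
    via-bottom : dist w z ≤ c + dist z (g j)
    via-bottom = subst (λ x → dist w z ≤ c + x) (dist-sym (g j) z) (dist-triangle w (g j) z)
    result : dist w z ≤ dist z a ⊎ dist w z ≤ dist z b
    result with Valley.valley-shape z j j≤D
    ... | inj₁ eq = inj₁ (≤-trans via-bottom (bounded-sum c≤j (trans eq (cong (dist z) g-start))))
    ... | inj₂ eq = inj₂ (≤-trans via-bottom (bounded-sum c≤t' (+-cancelʳ-≡ j _ _ (begin
          dist z (g j) + t' + j     ≡⟨ +-assoc (dist z (g j)) t' j ⟩
          dist z (g j) + (t' + j)   ≡⟨ cong (dist z (g j) +_) t'+j≡D ⟩
          dist z (g j) + D          ≡⟨ eq ⟩
          dist z (g D) + j          ≡⟨ cong (λ x → dist z x + j) g-end ⟩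
          dist z b + j              ∎))))
      where open ≡-Reasoning

module SubtreeMetric {m : ℕ} (T : SimpleGraph m) (tree : IsTree T) (S : Subset m) (st : Subtree T S) where
  open TreeMetric T tree

  private
    s₀ : Fin m
    s₀ = proj₁ (proj₁ st)
    s₀∈S : s₀ ∈ S
    s₀∈S = proj₂ (proj₁ st)

  farthest : Fin m → Fin m
  farthest u = Maximiser.maximiser S s₀ s₀∈S (dist u)

  ecc : Fin m → ℕ
  ecc u = dist u (farthest u)

  ecc-bound : ∀ u {v} → v ∈ S → dist u v ≤ ecc u
  ecc-bound u = Maximiser.maximiser-max S s₀ s₀∈S (dist u)

  Ecc-ecc : ∀ {u} → u ∈ S → Ecc T S u (ecc u)
  Ecc-ecc {u} u∈S =
    (λ {w} w∈S dist-w → subst (_≤ ecc u) (≡-sym (Dist⇒dist dist-w)) (ecc-bound u w∈S)) ,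
    farthest u , far∈S , dist-in-subtree (proj₂ st) u∈S far∈S
    where
    far∈S : farthest u ∈ S
    far∈S = Maximiser.maximiser-∈ S s₀ s₀∈S (dist u)

  Ecc-bound : ∀ {u e} → u ∈ S → Ecc T S u e → ∀ {v} → v ∈ S → dist u v ≤ e
  Ecc-bound u∈S (bound , _) v∈S = bound v∈S (dist-in-subtree (proj₂ st) u∈S v∈S)

  Ecc-attained : ∀ {u e} → Ecc T S u e → Σ (Fin m) λ w → w ∈ S × e ≡ dist u w
  Ecc-attained (_ , w , w∈S , dist-w) = w , w∈S , Dist⇒dist dist-w

  ecc-≤-radius : ∀ {c r} → (∀ {v} → v ∈ S → dist v c ≤ r) → ecc c ≤ r
  ecc-≤-radius {c} radius =
    subst (_≤ _) (dist-sym (farthest c) c) (radius (Maximiser.maximiser-∈ S s₀ s₀∈S (dist c)))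

  a₀ : Fin m
  a₀ = Maximiser.maximiser S s₀ s₀∈S ecc

  a₀∈S : a₀ ∈ S
  a₀∈S = Maximiser.maximiser-∈ S s₀ s₀∈S ecc

  b₀ : Fin m
  b₀ = farthest a₀

  b₀∈S : b₀ ∈ S
  b₀∈S = Maximiser.maximiser-∈ S s₀ s₀∈S (dist a₀)

  diam : ℕ
  diam = dist a₀ b₀

  diam-bound : ∀ {u v} → u ∈ S → v ∈ S → dist u v ≤ diam
  diam-bound {u} u∈S v∈S = ≤-trans (ecc-bound u v∈S) (Maximiser.maximiser-max S s₀ s₀∈S ecc u∈S)

  Diam-diam : Diam T S diam
  Diam-diam = (λ u∈S v∈S dist-uv → subst (_≤ diam) (≡-sym (Dist⇒dist dist-uv)) (diam-bound u∈S v∈S)) ,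
              a₀ , b₀ , a₀∈S , b₀∈S , dist-in-subtree (proj₂ st) a₀∈S b₀∈S

  diametral : Walk T S a₀ b₀ diam
  diametral = proj₁ (dist-in-subtree (proj₂ st) a₀∈S b₀∈S)

  open Geodesic T tree diametral using (g; g-∈; g-adj; within-radius; dominated) public

  ecc-lower : ∀ {v e} → v ∈ S → Ecc T S v e → diam ≤ e + e
  ecc-lower {v} v∈S ecc-v = ≤-trans (dist-triangle a₀ v b₀)
    (+-mono-≤ (subst (_≤ _) (dist-sym v a₀) (Ecc-bound v∈S ecc-v a₀∈S)) (Ecc-bound v∈S ecc-v b₀∈S))

  center-of-radius : ∀ {c r} → c ∈ S → (∀ {v} → v ∈ S → dist v c ≤ r) → r + r ≤ suc diam →
                     InCenter T S c
  center-of-radius {c} {r} c∈S radius 2r≤ = c∈S , λ {e} {v} {e'} ecc-c v∈S ecc-v →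
    let w , w∈S , e≡ = Ecc-attained ecc-c in
    subst (_≤ e') (≡-sym e≡)
      (≤-trans (subst (_≤ r) (dist-sym w c) (radius w∈S))
               (half-≤ (≤-trans 2r≤ (s≤s (ecc-lower v∈S ecc-v)))))

  midpoint : ∀ p r → p ≤ diam → p ≤ r → diam ≤ p + r → r + r ≤ suc diam →
             InCenter T S (g p) × (∀ {v} → v ∈ S → dist v (g p) ≤ r)
  midpoint p r p≤D p≤r D≤p+r 2r≤ = center-of-radius (g-∈ p) radius 2r≤ , radius
    where
    radius : ∀ {v} → v ∈ S → dist v (g p) ≤ r
    radius {v} v∈S = within-radius v p r p≤D p≤r D≤p+r (diam-bound v∈S a₀∈S) (diam-bound v∈S b₀∈S)

  middle : ∀ {q} → diam ≡ q + q → InCenter T S (g q) × (∀ {v} → v ∈ S → dist v (g q) ≤ q)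
  middle {q} even = midpoint q q (subst (q ≤_) (≡-sym even) (m≤m+n q q)) ≤-refl (≤-reflexive even)
                      (≤-trans (≤-reflexive (≡-sym even)) (n≤1+n diam))

  middle-pair : ∀ {q} → diam ≡ suc (q + q) →
                (InCenter T S (g q) × (∀ {v} → v ∈ S → dist v (g q) ≤ suc q)) ×
                (InCenter T S (g (suc q)) × (∀ {v} → v ∈ S → dist v (g (suc q)) ≤ suc q)) ×
                Adj T (g q) (g (suc q))
  middle-pair {q} odd =
    midpoint q (suc q) (≤-trans (n≤1+n q) q<diam) (n≤1+n q) (≤-reflexive (trans odd (≡-sym (+-suc q q)))) 2r≤ ,
    midpoint (suc q) (suc q) q<diam ≤-refl
             (≤-trans (≤-reflexive odd) (≤-trans (n≤1+n _) (s≤s (≤-reflexive (≡-sym (+-suc q q)))))) 2r≤ ,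
    g-adj q q<diam
    where
    q<diam : suc q ≤ diam
    q<diam = subst (suc q ≤_) (≡-sym odd) (s≤s (m≤m+n q q))
    2r≤ : suc q + suc q ≤ suc diam
    2r≤ = ≤-reflexive (cong suc (trans (+-suc q q) (≡-sym odd)))

  center-radius : Σ (Fin m) λ c → Σ ℕ λ r →
                  InCenter T S c × (∀ {v} → v ∈ S → dist v c ≤ r) × r + r ≤ suc diam
  center-radius = by-parity (parity diam)
    where
    by-parity : Σ ℕ (λ q → diam ≡ q + q ⊎ diam ≡ suc (q + q)) → Σ (Fin m) λ c → Σ ℕ λ r →
                InCenter T S c × (∀ {v} → v ∈ S → dist v c ≤ r) × r + r ≤ suc diam
    by-parity (q , inj₁ even) =
      g q , q , proj₁ (middle even) , proj₂ (middle even) ,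
      ≤-trans (≤-reflexive (≡-sym even)) (n≤1+n diam)
    by-parity (q , inj₂ odd) =
      g q , suc q , proj₁ (proj₁ (middle-pair odd)) , proj₂ (proj₁ (middle-pair odd)) ,
      ≤-reflexive (cong suc (trans (+-suc q q) (≡-sym odd)))

  near-center : ∀ {x} → x ∈ S → Σ (Fin m) λ c → InCenter T S c × dist x c + dist x c ≤ diam
  near-center {x} x∈S = by-parity (parity diam)
    where
    by-parity : Σ ℕ (λ q → diam ≡ q + q ⊎ diam ≡ suc (q + q)) →
                Σ (Fin m) λ c → InCenter T S c × dist x c + dist x c ≤ diam
    by-parity (q , inj₁ even) =
      g q , proj₁ (middle even) ,
      subst (dist x (g q) + dist x (g q) ≤_) (≡-sym even) (+-mono-≤ (proj₂ (middle even) x∈S) (proj₂ (middle even) x∈S))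
    by-parity (q , inj₂ odd) = nearer (adjacent-levels x (proj₂ (proj₂ pair)))
      where
      pair = middle-pair odd
      close : ∀ {e} → e ≤ q → e + e ≤ diam
      close e≤q = ≤-trans (+-mono-≤ e≤q e≤q) (subst (q + q ≤_) (≡-sym odd) (n≤1+n _))
      nearer : dist x (g (suc q)) ≡ suc (dist x (g q)) ⊎ dist x (g q) ≡ suc (dist x (g (suc q))) →
               Σ (Fin m) λ c → InCenter T S c × dist x c + dist x c ≤ diam
      nearer (inj₁ up) =
        g q , proj₁ (proj₁ pair) , close (s≤s⁻¹ (subst (_≤ suc q) up (proj₂ (proj₁ (proj₂ pair)) x∈S)))
      nearer (inj₂ down) =
        g (suc q) , proj₁ (proj₁ (proj₂ pair)) , close (s≤s⁻¹ (subst (_≤ suc q) down (proj₂ (proj₁ pair) x∈S)))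

module Cliques {n : ℕ} (G : SimpleGraph n) where

  absorbed : ∀ {C u} → IsMaximalClique G C → (∀ q → q ∈ C → q ≢ u → Adj G u q) → u ∈ C
  absorbed {C} {u} (clique , maximal) adj-all =
    maximal (C ∪ ⁅ u ⁆) clique' (p⊆p∪q ⁅ u ⁆) (q⊆p∪q C ⁅ u ⁆ (x∈⁅x⁆ u))
    where
    clique' : IsClique G (C ∪ ⁅ u ⁆)
    clique' {p} {q} p∈ q∈ p≢q with x∈p∪q⁻ C ⁅ u ⁆ p∈ | x∈p∪q⁻ C ⁅ u ⁆ q∈
    ... | inj₁ p∈C | inj₁ q∈C = clique p∈C q∈C p≢q
    ... | inj₁ p∈C | inj₂ q∈u with x∈⁅y⁆⇒x≡y u q∈u
    ...   | refl = sym G (adj-all p p∈C p≢q)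
    clique' {p} {q} p∈ q∈ p≢q | inj₂ p∈u | inj₁ q∈C with x∈⁅y⁆⇒x≡y u p∈u
    ...   | refl = adj-all q q∈C (λ q≡p → p≢q (≡-sym q≡p))
    clique' p∈ q∈ p≢q | inj₂ p∈u | inj₂ q∈u =
      ⊥-elim (p≢q (trans (x∈⁅y⁆⇒x≡y u p∈u) (≡-sym (x∈⁅y⁆⇒x≡y u q∈u))))

  non-neighbour : ∀ {C u} → IsMaximalClique G C → u ∉ C → Σ (Fin n) λ z → z ∈ C × z ≢ u × ¬ Adj G u z
  non-neighbour {C} {u} maximal u∉C
    with any? (λ z → (z ∈? C) ×-dec ¬? (z ≟ᶠ u) ×-dec ¬? (adj? G u z))
  ... | yes witness = witness
  ... | no none = ⊥-elim (u∉C (absorbed maximal adjacent))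
    where
    adjacent : ∀ q → q ∈ C → q ≢ u → Adj G u q
    adjacent q q∈C q≢u = decidable-stable (adj? G u q) (λ ¬adj → none (q , q∈C , q≢u , ¬adj))

  module CliqueIntersection {X : Subset n} (ci : IsCliqueIntersection G X) where

    family : List (Subset n)
    family = proj₁ (proj₂ ci)

    maximal : ∀ {C} → C ∈ᴸ family → IsMaximalClique G C
    maximal = All.lookup (proj₁ (proj₂ (proj₂ (proj₂ ci))))

    ⊆-member : ∀ {C x} → C ∈ᴸ family → x ∈ X → x ∈ C
    ⊆-member C∈ x∈X = All.lookup (proj₁ (proj₂ (proj₂ (proj₂ (proj₂ ci))) _) x∈X) C∈

    in-all-members : ∀ {u} → (∀ {C} → C ∈ᴸ family → u ∈ C) → u ∈ X
    in-all-members {u} in-all = proj₂ (proj₂ (proj₂ (proj₂ (proj₂ ci))) u) (All.tabulate in-all)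

    missed-by : ∀ {u} → u ∉ X → Σ (Subset n) λ C → C ∈ᴸ family × u ∉ C
    missed-by {u} u∉X =
      find (¬All⇒Any¬ (u ∈?_) family λ u∈all → u∉X (proj₂ (proj₂ (proj₂ (proj₂ (proj₂ ci))) u) u∈all))

    clique : IsClique G X
    clique x∈X y∈X x≢y = proj₁ (maximal C∈) (⊆-member C∈ x∈X) (⊆-member C∈ y∈X) x≢y
      where
      C∈ = proj₂ (nonempty-member family (proj₁ (proj₂ (proj₂ ci))))

-- The span of a nonempty vertex set X lies in the union of the geodesics between
-- points of X.
module Hull {n m : ℕ} (T : SimpleGraph m) (tree : IsTree T) (emb : Fin n → Fin m)
            (X : Subset n) (X≠∅ : Nonempty X) where
  open Walks T
  open TreeMetric T tree

  geodesic : Fin n → Fin n → ℕ → Fin m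
  geodesic x y = Geodesic.g T tree (dist-walk (emb x) (emb y))

  OnGeodesic : Fin m → Set
  OnGeodesic w = Σ (Fin n) λ x → Σ (Fin n) λ y → x ∈ X × y ∈ X ×
                 Σ ℕ λ i → i ≤ dist (emb x) (emb y) × geodesic x y i ≡ w

  onGeodesic? : ∀ w → Dec (OnGeodesic w)
  onGeodesic? w = any? λ x → any? λ y → (x ∈? X) ×-dec (y ∈? X) ×-dec
                    map′ (λ (i , i<1+D , eq) → i , s≤s⁻¹ i<1+D , eq) (λ (i , i≤D , eq) → i , s≤s i≤D , eq)
                         (anyUpTo? (λ i → geodesic x y i ≟ᶠ w) (suc (dist (emb x) (emb y))))

  hull : Subset m
  hull = tabulate (λ w → does (onGeodesic? w))

  ∈-hull : ∀ {w} → OnGeodesic w → w ∈ hull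
  ∈-hull {w} on = lookup⇒[]= w hull (trans (lookup∘tabulate _ w) (dec-true (onGeodesic? w) on))

  hull-∈ : ∀ {w} → w ∈ hull → OnGeodesic w
  hull-∈ {w} w∈ = from-does (onGeodesic? w) (trans (≡-sym (lookup∘tabulate _ w)) ([]=⇒lookup w∈))
    where
    from-does : (on? : Dec (OnGeodesic w)) → does on? ≡ true → OnGeodesic w
    from-does (yes on) _ = on
    from-does (no _) ()

  emb-∈-hull : ∀ {x} → x ∈ X → emb x ∈ hull
  emb-∈-hull {x} x∈X = ∈-hull (x , x , x∈X , x∈X , 0 , z≤n , Geodesic.g-start T tree (dist-walk (emb x) (emb x)))

  to-geodesic : ∀ {x y} → x ∈ X → y ∈ X → ∀ i → i ≤ dist (emb x) (emb y) →
                Walk T hull (emb x) (geodesic x y i) i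
  to-geodesic {x} {y} x∈X y∈X i i≤D =
    subst₂ (λ u v → Walk T hull u v i) (Geodesic.g-start T tree W) (cong (geodesic x y) (+-identityʳ i))
      (walkAlong (geodesic x y) i (λ j j<i → Geodesic.g-adj T tree W j (≤-trans j<i i≤D))
        (λ j j≤i → ∈-hull (x , y , x∈X , y∈X , j , ≤-trans j≤i i≤D , refl)) i 0
        (≤-reflexive (+-identityʳ i)))
    where
    W = dist-walk (emb x) (emb y)

  between : ∀ {x y} → x ∈ X → y ∈ X → Walk T hull (emb x) (emb y) (dist (emb x) (emb y))
  between {x} {y} x∈X y∈X =
    subst (λ v → Walk T hull (emb x) v (dist (emb x) (emb y))) (Geodesic.g-end T tree (dist-walk (emb x) (emb y)))
      (to-geodesic x∈X y∈X _ ≤-refl)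

  hull-subtree : Subtree T hull
  hull-subtree = (emb (proj₁ X≠∅) , emb-∈-hull (proj₂ X≠∅)) , connected-hull
    where
    connected-hull : ConnectedOn T hull
    connected-hull u∈ v∈ with hull-∈ u∈ | hull-∈ v∈
    ... | x₁ , y₁ , x₁∈ , y₁∈ , i₁ , i₁≤ , refl | x₂ , y₂ , x₂∈ , y₂∈ , i₂ , i₂≤ , refl =
      _ , reverseᵂ (to-geodesic x₁∈ y₁∈ i₁ i₁≤) ++ᵂ (between x₁∈ x₂∈ ++ᵂ to-geodesic x₂∈ y₂∈ i₂ i₂≤)

  span-bounded : ∀ {S} → IsSpan T emb X S → ∀ {w} → w ∈ S →
                 ∀ z B → (∀ {x} → x ∈ X → dist (emb x) z ≤ B) → dist w z ≤ B
  span-bounded (_ , _ , minimal) w∈S z B bound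
    with hull-∈ (minimal hull hull-subtree emb-∈-hull w∈S)
  ... | x , y , x∈X , y∈X , i , i≤D , refl
    with Geodesic.closer-than-an-end T tree (dist-walk (emb x) (emb y)) z i i≤D
  ...   | inj₁ closer = ≤-trans closer (bound x∈X)
  ...   | inj₂ closer = ≤-trans closer (bound y∈X)

module SteinerRoot {n m : ℕ} (k : ℕ) (G : SimpleGraph n) (T : SimpleGraph m) (emb : Fin n → Fin m)
                   (root : IsSteinerRoot k G T emb) where

  tree : IsTree T
  tree = proj₁ root

  open TreeMetric T tree
  open Cliques G

  near⇒adjacent : ∀ {x y} → x ≢ y → dist (emb x) (emb y) ≤ k → Adj G x y
  near⇒adjacent {x} {y} x≢y near = proj₂ (proj₂ (proj₂ root) x y x≢y) (_ , dist-in-subtree connected ∈⊤ ∈⊤ , near)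

  adjacent⇒near : ∀ {x y} → x ≢ y → Adj G x y → dist (emb x) (emb y) ≤ k
  adjacent⇒near {x} {y} x≢y adj with proj₁ (proj₂ (proj₂ root) x y x≢y) adj
  ... | _ , dist-xy , le = subst (_≤ k) (Dist⇒dist dist-xy) le

  clique-near : ∀ {C x y} → IsClique G C → x ∈ C → y ∈ C → dist (emb x) (emb y) ≤ k
  clique-near {x = x} {y} clique x∈C y∈C with x ≟ᶠ y
  ... | yes refl = subst (_≤ k) (≡-sym (dist-refl (emb x))) z≤n
  ... | no x≢y = adjacent⇒near x≢y (clique x∈C y∈C x≢y)

  module Span {X : Subset n} (ci : IsCliqueIntersection G X) {S : Subset m} (sp : IsSpan T emb X S) where
    open CliqueIntersection ci
    module S = SubtreeMetric T tree S (proj₁ sp)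

    emb-∈ : ∀ {x} → x ∈ X → emb x ∈ S
    emb-∈ = proj₁ (proj₂ sp)

    near-member : ∀ {C z} → C ∈ᴸ family → z ∈ C → ∀ {w} → w ∈ S → dist (emb z) w ≤ k
    near-member {C} {z} C∈ z∈C {w} w∈S =
      subst (_≤ k) (dist-sym w (emb z))
        (Hull.span-bounded T tree emb X (proj₁ ci) sp w∈S (emb z) k
          (λ x∈X → clique-near (proj₁ (maximal C∈)) (⊆-member C∈ x∈X) z∈C))

    real : RealIs emb S X
    real u = (λ u∈S → in-all-members λ C∈ → absorbed (maximal C∈) λ q q∈C q≢u →
                        near⇒adjacent (λ u≡q → q≢u (≡-sym u≡q))
                          (subst (_≤ k) (dist-sym (emb q) (emb u)) (near-member C∈ q∈C u∈S))) ,
             emb-∈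

    diam≤k : S.diam ≤ k
    diam≤k = subst (_≤ k) (dist-sym S.b₀ S.a₀)
      (Hull.span-bounded T tree emb X (proj₁ ci) sp S.b₀∈S S.a₀ k λ x∈X →
        subst (_≤ k) (dist-sym S.a₀ _)
          (Hull.span-bounded T tree emb X (proj₁ ci) sp S.a₀∈S _ k λ x'∈X → clique-near clique x'∈X x∈X))

    escapes : ∀ {u} → u ∉ X → Σ (Fin n) λ z → k < dist (emb u) (emb z) × (∀ {w} → w ∈ S → dist (emb z) w ≤ k)
    escapes u∉X with missed-by u∉X
    ... | C , C∈ , u∉C with non-neighbour (maximal C∈) u∉C
    ...   | z , z∈C , z≢u , ¬adj =
      z , ≰⇒> (λ near → ¬adj (near⇒adjacent (λ u≡z → z≢u (≡-sym u≡z)) near)) , near-member C∈ z∈C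

    -- (2) a strictly larger subtree S' either has the same real vertices or a larger diameter:
    -- a new real vertex u escapes, so it cannot be within diam S of both ends of S
    extension : ∀ S' → Subtree T S' → _⊂_ T S S' →
                RealIs emb S' X ⊎ ∃[ d ] ∃[ d' ] (Diam T S' d × Diam T S d' × d' < d)
    extension S' st' (S⊆S' , _) with any? (λ u → (emb u ∈? S') ×-dec ¬? (u ∈? X))
    ... | no none = inj₁ λ u → (λ u∈S' → decidable-stable (u ∈? X) (λ u∉X → none (u , u∈S' , u∉X))) ,
                                λ u∈X → S⊆S' (emb-∈ u∈X)
    ... | yes (u , u∈S' , u∉X) = inj₂ (S'.diam , S.diam , S'.Diam-diam , S.Diam-diam , grows)
      where
      module S' = SubtreeMetric T tree S' st'
      z = proj₁ (escapes u∉X)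
      u-far : k < dist (emb u) (emb z)
      u-far = proj₁ (proj₂ (escapes u∉X))
      z-near : ∀ {w} → w ∈ S → dist (emb z) w ≤ k
      z-near = proj₂ (proj₂ (escapes u∉X))
      grows : S.diam < S'.diam
      grows with dist (emb u) S.a₀ ≤? S.diam | dist (emb u) S.b₀ ≤? S.diam
      ... | no far-a | _ = ≤-trans (≰⇒> far-a) (S'.diam-bound u∈S' (S⊆S' S.a₀∈S))
      ... | yes _ | no far-b = ≤-trans (≰⇒> far-b) (S'.diam-bound u∈S' (S⊆S' S.b₀∈S))
      ... | yes near-a | yes near-b with S.dominated (emb u) (emb z) near-a near-b
      ...   | inj₁ by-a = ⊥-elim (<-irrefl refl (≤-trans u-far (≤-trans by-a (z-near S.a₀∈S))))
      ...   | inj₂ by-b = ⊥-elim (<-irrefl refl (≤-trans u-far (≤-trans by-b (z-near S.b₀∈S))))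

  -- (3) if every center of S = T⟨X⟩ is a center of S' = T⟨X'⟩, then X ∪ X' is a clique:
  -- x is within diam(S)/2 of a center c of S, and c, being a center of S', has
  -- eccentricity at most ⌈diam(S')/2⌉ in S'.
  module SharedCenter {X X' : Subset n} {S S' : Subset m}
                      (ci : IsCliqueIntersection G X) (sp : IsSpan T emb X S)
                      (ci' : IsCliqueIntersection G X') (sp' : IsSpan T emb X' S')
                      (shared : ∀ c → InCenter T S c → InCenter T S' c) where
    module Sp = Span ci sp
    module Sp' = Span ci' sp'

    cross-near : ∀ {x x'} → x ∈ X → x' ∈ X' → dist (emb x) (emb x') ≤ k
    cross-near {x} {x'} x∈X x'∈X' with Sp.S.near-center (Sp.emb-∈ x∈X) | Sp'.S.center-radius
    ... | c , c-center , x-near | c' , r' , c'-center , radius' , 2r'≤ =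
      ≤-trans (dist-triangle (emb x) c (emb x'))
        (sum-of-halves {dist (emb x) c} {dist c (emb x')} (≤-trans x-near Sp.diam≤k)
                       (≤-trans (+-mono-≤ c-to-x' c-to-x') (≤-trans 2r'≤ (s≤s Sp'.diam≤k))))
      where
      c∈S' : c ∈ S'
      c∈S' = proj₁ (shared c c-center)
      -- ecc_S'(c) ≤ ecc_S'(c') ≤ r', as c is a center of S'
      c-to-x' : dist c (emb x') ≤ r'
      c-to-x' = ≤-trans (Sp'.S.ecc-bound c (Sp'.emb-∈ x'∈X'))
                  (≤-trans (proj₂ (shared c c-center) (Sp'.S.Ecc-ecc c∈S') (proj₁ c'-center)
                                                     (Sp'.S.Ecc-ecc (proj₁ c'-center)))
                           (Sp'.S.ecc-≤-radius radius'))

    union-clique : IsClique G (X ∪ X')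
    union-clique {u} {v} u∈ v∈ u≢v with x∈p∪q⁻ X X' u∈ | x∈p∪q⁻ X X' v∈
    ... | inj₁ u∈X  | inj₁ v∈X  = CliqueIntersection.clique ci u∈X v∈X u≢v
    ... | inj₂ u∈X' | inj₂ v∈X' = CliqueIntersection.clique ci' u∈X' v∈X' u≢v
    ... | inj₁ u∈X  | inj₂ v∈X' = near⇒adjacent u≢v (cross-near u∈X v∈X')
    ... | inj₂ u∈X' | inj₁ v∈X  = sym G (near⇒adjacent (λ v≡u → u≢v (≡-sym v≡u)) (cross-near v∈X u∈X'))

theorem3p4 : ∀ {n m : ℕ} (k : ℕ) → 1 ≤ k →
    (G : SimpleGraph n) (T : SimpleGraph m) (emb : Fin n → Fin m) →
    IsSteinerRoot k G T emb →
    ∀ (X : Subset n) → IsCliqueIntersection G X →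
    ∀ (S : Subset m) → IsSpan T emb X S →
      (RealIs emb S X × ∃[ d ] (Diam T S d × d ≤ k))
      × (∀ (S' : Subset m) → Subtree T S' → _⊂_ T S S' →
           RealIs emb S' X
           ⊎ ∃[ d ] ∃[ d' ] (Diam T S' d × Diam T S d' × d' < d))
      × (∀ (X' : Subset n) → IsCliqueIntersection G X' →
           ∀ (S' : Subset m) → IsSpan T emb X' S' →
           (∀ c → InCenter T S c → InCenter T S' c) →
           IsClique G (X ∪ X'))
theorem3p4 k _ G T emb root X ci S sp =
  (real , S.diam , S.Diam-diam , diam≤k) ,
  extension ,
  λ X' ci' S' sp' shared → SharedCenter.union-clique ci sp ci' sp' shared
  where
  open SteinerRoot k G T emb root
  open Span ci sp
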